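{- Let $d>0$ and $N\geq d$ be integers, and let $c\geq 0$ and $m>0$ be integers satisfying $$\frac1d\leq \frac cm<\left(1+\frac1N\right)\frac1d.$$ Then for every integer $n\in[0,N]$, $d$ divides $n$ if and only if $\operatorname{rem}(c\cdot n,m)<c$.
   Context: For a non-negative real $x$ and a positive real $y$, $\operatorname{rem}(x,y)=x-\lfloor x/y\rfloor\cdot y$, where $\lfloor\cdot\rfloor$ is the floor function. -}

module Defs where

open import Data.Nat using (ℕ; NonZero)
open import Data.Nat.DivMod using (_%_)

rem : (x y : ℕ) → .{{NonZero y}} → ℕ
rem x y = x % y

-- Write d c = m + e.  Splitting n = q d + r with r < d gives c n = q m + s with
-- s = q e + r c, and d s = e n + r m.  Since e n ≤ e N < m (this is the upper bound
-- on c/m), d s < (r + 1) m ≤ d m, so s < m is the remainder of c n modulo m.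
-- If r = 0 then d s = e n < m ≤ d c, so s < c; otherwise s ≥ r c ≥ c.
module Submission where

open import Defs
open import Data.List using ([]; _∷_)
open import Data.Nat using (ℕ; zero; suc; _+_; _*_; _∸_; _≤_; _<_; NonZero; _/_; _%_)
open import Data.Nat.Divisibility using (_∣_; m%n≡0⇒n∣m; n∣m⇒m%n≡0)
open import Data.Nat.DivMod using (m≡m%n+[m/n]*n; m%n<n; [m+kn]%n≡m%n; m<n⇒m%n≡m)
open import Data.Nat.Properties
open import Data.Nat.Tactic.RingSolver using (solve)
open import Function.Bundles using (_⇔_; mk⇔)
open import Relation.Binary.PropositionalEquality
open import Relation.Nullary using (contradiction)

m<n⇒[m+kn]%n≡m : ∀ {s m} .{{_ : NonZero m}} q → s < m → (s + q * m) % m ≡ s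
m<n⇒[m+kn]%n≡m {s} {m} q s<m = trans ([m+kn]%n≡m%n s q m) (m<n⇒m%n≡m s<m)

dc≡m+e⇒dcN<m[N+1]⇒eN<m : ∀ d c {m e} N → d * c ≡ m + e → d * c * N < m * (N + 1) → e * N < m
dc≡m+e⇒dcN<m[N+1]⇒eN<m d c {m} {e} N dc≡m+e dcN<m[N+1] = +-cancelˡ-< (m * N) (e * N) m (begin-strict
  m * N + e * N ≡⟨ solve (m ∷ e ∷ N ∷ []) ⟩
  (m + e) * N   ≡⟨ cong (_* N) (sym dc≡m+e) ⟩
  d * c * N     <⟨ dcN<m[N+1] ⟩
  m * (N + 1)   ≡⟨ solve (m ∷ N ∷ []) ⟩
  m * N + m     ∎)
  where open ≤-Reasoning

module _ {m e n : ℕ} (d c q r : ℕ) (dc≡m+e : d * c ≡ m + e) (n≡r+q*d : n ≡ r + q * d) where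

  c*n≡ : c * n ≡ (q * e + r * c) + q * m
  c*n≡ = begin
    c * n                     ≡⟨ cong (c *_) n≡r+q*d ⟩
    c * (r + q * d)           ≡⟨ solve (c ∷ r ∷ q ∷ d ∷ []) ⟩
    r * c + q * (d * c)       ≡⟨ cong (λ x → r * c + q * x) dc≡m+e ⟩
    r * c + q * (m + e)       ≡⟨ solve (r ∷ c ∷ q ∷ m ∷ e ∷ []) ⟩
    (q * e + r * c) + q * m   ∎
    where open ≡-Reasoning

  d*[q*e+r*c]≡ : d * (q * e + r * c) ≡ e * n + r * m
  d*[q*e+r*c]≡ = begin
    d * (q * e + r * c)       ≡⟨ solve (d ∷ q ∷ e ∷ r ∷ c ∷ []) ⟩
    e * (q * d) + r * (d * c) ≡⟨ cong (λ x → e * (q * d) + r * x) dc≡m+e ⟩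
    e * (q * d) + r * (m + e) ≡⟨ solve (e ∷ q ∷ d ∷ r ∷ m ∷ []) ⟩
    e * (r + q * d) + r * m   ≡⟨ cong (λ x → e * x + r * m) (sym n≡r+q*d) ⟩
    e * n + r * m             ∎
    where open ≡-Reasoning

  c*n%m≡ : .{{_ : NonZero m}} → r < d → e * n < m → (c * n) % m ≡ q * e + r * c
  c*n%m≡ r<d en<m = trans (cong (_% m) c*n≡) (m<n⇒[m+kn]%n≡m q s<m)
    where
    open ≤-Reasoning
    s<m : q * e + r * c < m
    s<m = *-cancelˡ-< d _ m (begin-strict
      d * (q * e + r * c) ≡⟨ d*[q*e+r*c]≡ ⟩
      e * n + r * m       <⟨ +-monoˡ-< (r * m) en<m ⟩
      suc r * m           ≤⟨ *-monoˡ-≤ m r<d ⟩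
      d * m               ∎)

  r≡0⇒q*e+r*c<c : e * n < m → r ≡ 0 → q * e + r * c < c
  r≡0⇒q*e+r*c<c en<m refl = *-cancelˡ-< d _ c (begin-strict
    d * (q * e + 0)     ≡⟨ d*[q*e+r*c]≡ ⟩
    e * n + 0           ≡⟨ +-identityʳ (e * n) ⟩
    e * n               <⟨ en<m ⟩
    m                   ≤⟨ m≤m+n m e ⟩
    m + e               ≡⟨ sym dc≡m+e ⟩
    d * c               ∎)
    where open ≤-Reasoning

q*e+r*c<c⇒r≡0 : ∀ {c} q e r → q * e + r * c < c → r ≡ 0
q*e+r*c<c⇒r≡0         q e zero    _  = refl
q*e+r*c<c⇒r≡0 {c} q e (suc r) s<c = contradiction s<c (≤⇒≯ (begin
  c                   ≤⟨ m≤m+n c (r * c) ⟩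
  suc r * c           ≤⟨ m≤n+m (suc r * c) (q * e) ⟩
  q * e + suc r * c   ∎))
  where open ≤-Reasoning

proposition1 : (d N c m : ℕ) → .{{_ : NonZero d}} → .{{_ : NonZero m}} → d ≤ N →
    m ≤ d * c → d * c * N < m * (N + 1) →
    (n : ℕ) → n ≤ N → (d ∣ n) ⇔ (rem (c * n) m < c)
proposition1 d N c m _ m≤dc dcN<m[N+1] n n≤N = mk⇔
  (λ d∣n → subst (_< c) (sym c*n%m≡s)
              (r≡0⇒q*e+r*c<c d c q r dc≡m+e n≡r+q*d en<m (n∣m⇒m%n≡0 n d d∣n)))
  (λ rem<c → m%n≡0⇒n∣m n d
              (q*e+r*c<c⇒r≡0 q e r (subst (_< c) c*n%m≡s rem<c)))
  where
  e q r : ℕ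
  e = d * c ∸ m
  q = n / d
  r = n % d

  dc≡m+e : d * c ≡ m + e
  dc≡m+e = sym (m+[n∸m]≡n m≤dc)

  n≡r+q*d : n ≡ r + q * d
  n≡r+q*d = m≡m%n+[m/n]*n n d

  en<m : e * n < m
  en<m = ≤-<-trans (*-monoʳ-≤ e n≤N) (dc≡m+e⇒dcN<m[N+1]⇒eN<m d c N dc≡m+e dcN<m[N+1])

  c*n%m≡s : rem (c * n) m ≡ q * e + r * c
  c*n%m≡s = c*n%m≡ d c q r dc≡m+e n≡r+q*d (m%n<n n d) en<m
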